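{- Let $\mathbb{T}=(T,\eta,(-)^{\sharp})$ be a monad on a category $\mathbf{C}$ with binary coproducts, and let $(-)^{\dagger}\colon\mathbf{C}(X,T(Y+X))\to\mathbf{C}(X,TY)$ be an operator satisfying Fixpoint, Codiagonal and Uniformity, and satisfying Naturality for all $g$ of the form $\eta\,\mathrm{inr}\colon Y\to T(Y'+Y)$ (for all objects $Y,Y'$). Then $(-)^{\dagger}$ satisfies Naturality in full generality, so $(\mathbb{T},(-)^{\dagger})$ is an Elgot monad.
   Context: Notation: $\mathrm{inl},\mathrm{inr}$ coproduct injections, $[f,g]$ copairing, $f\cdot g=f^{\sharp}\circ g$ Kleisli composition, $\eta h=\eta\circ h$. Fixpoint: $[\eta,f^{\dagger}]\cdot f=f^{\dagger}$ for all $f\colon X\to T(Y+X)$. Naturality: $g\cdot f^{\dagger}=([\eta\,\mathrm{inl}\cdot g,\eta\,\mathrm{inr}]\cdot f)^{\dagger}$ for all $g\colon Y\to TZ$, $f\colon X\to T(Y+X)$. Codiagonal: $f^{\dagger\dagger}=([\eta,\eta\,\mathrm{inr}]\cdot f)^{\dagger}$ for all $f\colon X\to T((Y+X)+X)$. Uniformity: for $h\colon X\to Z$ in $\mathbf{C}$, $g\colon Z\to T(Y+Z)$, $f\colon X\to T(Y+X)$: if $g\cdot\eta h=\eta(\mathrm{id}+h)\cdot f$ then $g^{\dagger}\cdot\eta h=f^{\dagger}$. An Elgot monad is a monad with an operator $(-)^{\dagger}$ satisfying these four laws. -}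

module Defs where

open import Level using (Level; _⊔_; suc)
open import Relation.Binary.PropositionalEquality using (_≡_)
open import Data.Product using (_×_)

record Category (o ℓ : Level) : Set (suc (o ⊔ ℓ)) where
  infixr 9 _∘_
  field
    Obj  : Set o
    Hom  : Obj → Obj → Set ℓ
    id   : ∀ {A} → Hom A A
    _∘_  : ∀ {A B C} → Hom B C → Hom A B → Hom A C
    identityˡ : ∀ {A B} {f : Hom A B} → id ∘ f ≡ f
    identityʳ : ∀ {A B} {f : Hom A B} → f ∘ id ≡ f
    assoc     : ∀ {A B C D} {f : Hom A B} {g : Hom B C} {h : Hom C D} →
                (h ∘ g) ∘ f ≡ h ∘ (g ∘ f)

record BinaryCoproducts {o ℓ} (C : Category o ℓ) : Set (o ⊔ ℓ) where
  open Category C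
  infixr 6 _+_
  field
    _+_  : Obj → Obj → Obj
    inl  : ∀ {A B} → Hom A (A + B)
    inr  : ∀ {A B} → Hom B (A + B)
    [_,_] : ∀ {A B Z} → Hom A Z → Hom B Z → Hom (A + B) Z
    inject₁ : ∀ {A B Z} {f : Hom A Z} {g : Hom B Z} → [ f , g ] ∘ inl ≡ f
    inject₂ : ∀ {A B Z} {f : Hom A Z} {g : Hom B Z} → [ f , g ] ∘ inr ≡ g
    unique  : ∀ {A B Z} {f : Hom A Z} {g : Hom B Z} {h : Hom (A + B) Z} →
              h ∘ inl ≡ f → h ∘ inr ≡ g → h ≡ [ f , g ]

record KleisliTriple {o ℓ} (C : Category o ℓ) : Set (o ⊔ ℓ) where
  open Category C
  field
    T    : Obj → Obj
    η    : ∀ {A} → Hom A (T A)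
    _♯   : ∀ {A B} → Hom A (T B) → Hom (T A) (T B)
    η♯      : ∀ {A} → (η {A}) ♯ ≡ id
    ♯-η     : ∀ {A B} {f : Hom A (T B)} → f ♯ ∘ η ≡ f
    ♯-assoc : ∀ {A B D} {f : Hom A (T B)} {g : Hom B (T D)} →
              (g ♯ ∘ f) ♯ ≡ g ♯ ∘ f ♯

module Iteration {o ℓ} {C : Category o ℓ} (CP : BinaryCoproducts C)
                 (M : KleisliTriple C) where
  open Category C
  open BinaryCoproducts CP
  open KleisliTriple M

  infixr 8 _·_
  _·_ : ∀ {A B D} → Hom B (T D) → Hom A (T B) → Hom A (T D)
  f · g = f ♯ ∘ g

  _⊕_ : ∀ {A B D E} → Hom A B → Hom D E → Hom (A + D) (B + E)
  f ⊕ g = [ inl ∘ f , inr ∘ g ]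

  DaggerOp : Set (o ⊔ ℓ)
  DaggerOp = ∀ {X Y} → Hom X (T (Y + X)) → Hom X (T Y)

  module _ (_† : DaggerOp) where

    Fixpoint : Set (o ⊔ ℓ)
    Fixpoint = ∀ {X Y} (f : Hom X (T (Y + X))) → [ η , f † ] · f ≡ f †

    Naturality : Set (o ⊔ ℓ)
    Naturality = ∀ {X Y Z} (g : Hom Y (T Z)) (f : Hom X (T (Y + X))) →
      g · (f †) ≡ ([ η ∘ inl · g , η ∘ inr ] · f) †

    NaturalityInr : Set (o ⊔ ℓ)
    NaturalityInr = ∀ {X Y Y'} (f : Hom X (T (Y + X))) →
      (η ∘ inr {Y'} {Y}) · (f †) ≡ ([ η ∘ inl · (η ∘ inr) , η ∘ inr ] · f) †

    Codiagonal : Set (o ⊔ ℓ)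
    Codiagonal = ∀ {X Y} (f : Hom X (T ((Y + X) + X))) →
      (f †) † ≡ ([ η , η ∘ inr ] · f) †

    Uniformity : Set (o ⊔ ℓ)
    Uniformity = ∀ {X Y Z} (h : Hom X Z) (g : Hom Z (T (Y + Z)))
      (f : Hom X (T (Y + X))) →
      g · (η ∘ h) ≡ η ∘ (id ⊕ h) · f → (g †) · (η ∘ h) ≡ f †

    record IsElgot : Set (o ⊔ ℓ) where
      field
        fixpoint   : Fixpoint
        naturality : Naturality
        codiagonal : Codiagonal
        uniformity : Uniformity

module Submission where

open import Relation.Binary.PropositionalEquality
open import Defs

-- Given g : Y → TZ and f : X → T(Y + X), iterate on X + Y two loops with the same exit g on
-- the Y-summand: σ, which on X runs f† (reindexed into the larger type by NaturalityInr),
-- and ρ, which on X runs h = [η inl · g, η inr] · f.  By Fixpoint σ† inl = g · f†, and by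
-- Uniformity ρ† inl = h†.  Finally σ and ρ are the inner iterates of two doubly iterated
-- loops whose codiagonal collapses coincide, so Codiagonal gives σ† = ρ†.

module IterationLemmas {o ℓ} {C : Category o ℓ} (CP : BinaryCoproducts C)
                       (M : KleisliTriple C) where
  open Category C
  open BinaryCoproducts CP
  open KleisliTriple M
  open Iteration CP M
  open ≡-Reasoning

  ·-assoc : ∀ {A B D E} {h : Hom D (T E)} {g : Hom B (T D)} {f : Hom A (T B)} →
    (h · g) · f ≡ h · (g · f)
  ·-assoc {f = f} = trans (cong (_∘ f) ♯-assoc) assoc

  ·-identityˡ : ∀ {A B} {f : Hom A (T B)} → η · f ≡ f
  ·-identityˡ {f = f} = trans (cong (_∘ f) η♯) identityˡ

  ·-η∘ : ∀ {A B D} {f : Hom B (T D)} {m : Hom A B} → f · (η ∘ m) ≡ f ∘ m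
  ·-η∘ {m = m} = trans (sym assoc) (cong (_∘ m) ♯-η)

  ·-absorbs-η∘ : ∀ {A B D E} {k : Hom B (T E)} {m : Hom D B} {u : Hom A (T D)} →
    k · ((η ∘ m) · u) ≡ (k ∘ m) · u
  ·-absorbs-η∘ {u = u} = trans (sym ·-assoc) (cong (_· u) ·-η∘)

  []-ext : ∀ {A B Z} {h k : Hom (A + B) Z} →
    h ∘ inl ≡ k ∘ inl → h ∘ inr ≡ k ∘ inr → h ≡ k
  []-ext p q = trans (unique p q) (sym (unique refl refl))

  ∘-[] : ∀ {A B Z W} {h : Hom Z W} {a : Hom A Z} {b : Hom B Z} →
    h ∘ [ a , b ] ≡ [ h ∘ a , h ∘ b ]
  ∘-[] {h = h} = unique (trans assoc (cong (h ∘_) inject₁))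
                        (trans assoc (cong (h ∘_) inject₂))

  []-·-η∘inl : ∀ {A B D Z} {a : Hom A (T Z)} {b : Hom B (T Z)} {m : Hom D A} →
    [ a , b ] · (η ∘ (inl ∘ m)) ≡ a ∘ m
  []-·-η∘inl {m = m} = trans ·-η∘ (trans (sym assoc) (cong (_∘ m) inject₁))

  []-·-η∘inr : ∀ {A B D Z} {a : Hom A (T Z)} {b : Hom B (T Z)} {m : Hom D B} →
    [ a , b ] · (η ∘ (inr ∘ m)) ≡ b ∘ m
  []-·-η∘inr {m = m} = trans ·-η∘ (trans (sym assoc) (cong (_∘ m) inject₂))

  []-·-exit : ∀ {A B D W} {a : Hom A (T D)} {b : Hom B (T D)} {u : Hom W (T A)} →
    [ a , b ] · ((η ∘ inl) · u) ≡ a · u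
  []-·-exit {u = u} = trans ·-absorbs-η∘ (cong (_· u) inject₁)

  relabel-continue : ∀ {A B D W} {m : Hom A B} {u : Hom W (T D)} →
    (η ∘ (id ⊕ m)) · [ (η ∘ inl) · u , η ∘ inr ] ≡ [ (η ∘ inl) · u , η ∘ (inr ∘ m) ]
  relabel-continue {m = m} {u} = trans ∘-[] (cong₂ [_,_]
    (trans ·-absorbs-η∘ (cong (_· u) (trans assoc (cong (η ∘_) (trans inject₁ identityʳ)))))
    (trans ·-η∘ (trans assoc (cong (η ∘_) inject₂))))

  map₁-inr : ∀ {W X Y} → Hom X (T (Y + X)) → Hom X (T ((W + Y) + X))
  map₁-inr f = [ (η ∘ inl) · (η ∘ inr) , η ∘ inr ] · f

  []-·-map₁-inr : ∀ {W X Y D} {p : Hom (W + Y) (T D)} {b : Hom X (T D)}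
    {f : Hom X (T (Y + X))} → [ p , b ] · map₁-inr f ≡ [ p ∘ inr , b ] · f
  []-·-map₁-inr {p = p} {f = f} = trans (sym ·-assoc) (cong (_· f) (trans ∘-[]
    (cong₂ [_,_] (trans []-·-exit ·-η∘) (trans ·-η∘ inject₂))))

  module DaggerLemmas (_† : DaggerOp) where

    †-unfold : Fixpoint _† → ∀ {X Y A} (k : Hom X (T (Y + X))) {e : Hom A X} →
      k † ∘ e ≡ [ η , k † ] · (k ∘ e)
    †-unfold fixpoint k {e} = trans (cong (_∘ e) (sym (fixpoint k))) assoc

    †-exit : Fixpoint _† → ∀ {X Y A} (k : Hom X (T (Y + X))) {e : Hom A X}
      {u : Hom A (T Y)} → k ∘ e ≡ (η ∘ inl) · u → k † ∘ e ≡ u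
    †-exit fixpoint k {u = u} p = begin
      k † ∘ _                      ≡⟨ †-unfold fixpoint k ⟩
      [ η , k † ] · (k ∘ _)        ≡⟨ cong ([ η , k † ] ·_) p ⟩
      [ η , k † ] · ((η ∘ inl) · u) ≡⟨ []-·-exit ⟩
      η · u                        ≡⟨ ·-identityˡ ⟩
      u                            ∎

    uniform-along : Uniformity _† → ∀ {X Y Z} {m : Hom X Z} (k : Hom Z (T (Y + Z)))
      {f : Hom X (T (Y + X))} → k ∘ m ≡ (η ∘ (id ⊕ m)) · f → k † ∘ m ≡ f †
    uniform-along uniformity {m = m} k {f} p =
      trans (sym ·-η∘) (uniformity m k f (trans ·-η∘ p))

    codiagonal-transfer : Codiagonal _† → ∀ {X Y} {σ ρ : Hom X (T (Y + X))}
      (τ τ′ : Hom X (T ((Y + X) + X))) → τ † ≡ σ → τ′ † ≡ ρ →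
      [ η , η ∘ inr ] · τ ≡ [ η , η ∘ inr ] · τ′ → σ † ≡ ρ †
    codiagonal-transfer codiagonal {σ = σ} {ρ} τ τ′ τ†≡σ τ′†≡ρ collapse = begin
      σ †                       ≡⟨ cong _† (sym τ†≡σ) ⟩
      τ † †                     ≡⟨ codiagonal τ ⟩
      ([ η , η ∘ inr ] · τ) †  ≡⟨ cong _† collapse ⟩
      ([ η , η ∘ inr ] · τ′) † ≡⟨ sym (codiagonal τ′) ⟩
      τ′ † †                    ≡⟨ cong _† τ′†≡ρ ⟩
      ρ †                       ∎

  module NaturalityFromInr (_† : DaggerOp) (fixpoint : Fixpoint _†)
                           (codiagonal : Codiagonal _†) (uniformity : Uniformity _†)
                           (naturalityInr : NaturalityInr _†)
                           {X Y Z : Obj} (g : Hom Y (T Z)) (f : Hom X (T (Y + X))) where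
    open DaggerLemmas _†

    ĝ : ∀ {B} → Hom Y (T (Z + B))
    ĝ = (η ∘ inl) · g

    h : Hom X (T (Z + X))
    h = [ ĝ , η ∘ inr ] · f

    f′ : Hom X (T ((Z + (X + Y)) + X))
    f′ = map₁-inr (map₁-inr f)

    f′† : f′ † ≡ (η ∘ inr) · ((η ∘ inr) · f †)
    f′† = begin
      f′ †                              ≡⟨ sym (naturalityInr (map₁-inr f)) ⟩
      (η ∘ inr) · map₁-inr f †          ≡⟨ cong ((η ∘ inr) ·_) (sym (naturalityInr f)) ⟩
      (η ∘ inr) · ((η ∘ inr) · f †)     ∎

    σ : Hom (X + Y) (T (Z + (X + Y)))
    σ = [ f′ † , ĝ ]

    σ†∘inr : σ † ∘ inr ≡ g
    σ†∘inr = †-exit fixpoint σ inject₂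

    σ†∘inl : σ † ∘ inl ≡ g · f †
    σ†∘inl = begin
      σ † ∘ inl                                   ≡⟨ †-unfold fixpoint σ ⟩
      [ η , σ † ] · (σ ∘ inl)                     ≡⟨ cong ([ η , σ † ] ·_) (trans inject₁ f′†) ⟩
      [ η , σ † ] · ((η ∘ inr) · ((η ∘ inr) · f †)) ≡⟨ ·-absorbs-η∘ ⟩
      ([ η , σ † ] ∘ inr) · ((η ∘ inr) · f †)     ≡⟨ cong (_· ((η ∘ inr) · f †)) inject₂ ⟩
      σ † · ((η ∘ inr) · f †)                     ≡⟨ ·-absorbs-η∘ ⟩
      (σ † ∘ inr) · f †                           ≡⟨ cong (_· f †) σ†∘inr ⟩
      g · f †                                     ∎

    ρ : Hom (X + Y) (T (Z + (X + Y)))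
    ρ = [ (η ∘ (id ⊕ inl)) · h , ĝ ]

    ρ†∘inl : ρ † ∘ inl ≡ h †
    ρ†∘inl = uniform-along uniformity ρ inject₁

    τ : Hom (X + Y) (T ((Z + (X + Y)) + (X + Y)))
    τ = [ (η ∘ (id ⊕ inl)) · f′ , (η ∘ inl) · ĝ ]

    τ† : τ † ≡ σ
    τ† = []-ext (trans (uniform-along uniformity τ inject₁) (sym inject₁))
                (trans (†-exit fixpoint τ inject₂) (sym inject₂))

    -- Exits of f re-enter the outer loop at the Y-summand, while continuations leave the
    -- inner loop; so the inner iterate of τ′ is ρ, yet τ′ collapses exactly like τ.
    τ′ : Hom (X + Y) (T ((Z + (X + Y)) + (X + Y)))
    τ′ = [ [ (η ∘ inr) ∘ inr , η ∘ (inl ∘ (inr ∘ inl)) ] · f , (η ∘ inl) · ĝ ]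

    τ′† : τ′ † ≡ ρ
    τ′† = []-ext l (trans (†-exit fixpoint τ′ inject₂) (sym inject₂))
      where
      k : Hom ((Z + (X + Y)) + (X + Y)) (T (Z + (X + Y)))
      k = [ η , τ′ † ]
      l : τ′ † ∘ inl ≡ ρ ∘ inl
      l = begin
        τ′ † ∘ inl                                   ≡⟨ †-unfold fixpoint τ′ ⟩
        k · (τ′ ∘ inl)                               ≡⟨ cong (k ·_) inject₁ ⟩
        k · ([ (η ∘ inr) ∘ inr , η ∘ (inl ∘ (inr ∘ inl)) ] · f) ≡⟨ sym ·-assoc ⟩
        (k · [ (η ∘ inr) ∘ inr , η ∘ (inl ∘ (inr ∘ inl)) ]) · f ≡⟨ cong (_· f) ∘-[] ⟩
        [ k · ((η ∘ inr) ∘ inr) , k · (η ∘ (inl ∘ (inr ∘ inl))) ] · f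
          ≡⟨ cong (λ c → [ c , k · (η ∘ (inl ∘ (inr ∘ inl))) ] · f)
                  (trans (cong (k ·_) assoc)
                         (trans []-·-η∘inr (†-exit fixpoint τ′ inject₂))) ⟩
        [ ĝ , k · (η ∘ (inl ∘ (inr ∘ inl))) ] · f   ≡⟨ cong (λ c → [ ĝ , c ] · f) []-·-η∘inl ⟩
        [ ĝ , η ∘ (inr ∘ inl) ] · f                  ≡⟨ cong (_· f) (sym relabel-continue) ⟩
        ((η ∘ (id ⊕ inl)) · [ ĝ , η ∘ inr ]) · f     ≡⟨ ·-assoc ⟩
        (η ∘ (id ⊕ inl)) · h                         ≡⟨ sym inject₁ ⟩
        ρ ∘ inl                                      ∎

    collapse : [ η , η ∘ inr ] · τ ≡ [ η , η ∘ inr ] · τ′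
    collapse = []-ext (trans assoc (trans τ-route (sym (trans assoc τ′-route))))
                      (trans collapse∘inr (sym collapse∘inr))
      where
      k : Hom ((Z + (X + Y)) + (X + Y)) (T (Z + (X + Y)))
      k = [ η , η ∘ inr ]
      N : Hom X (T (Z + (X + Y)))
      N = [ (η ∘ inr) ∘ inr , η ∘ (inr ∘ inl) ] · f
      collapse∘inr : ∀ {a : Hom X (T ((Z + (X + Y)) + (X + Y)))} →
        (k · [ a , (η ∘ inl) · ĝ ]) ∘ inr ≡ ĝ
      collapse∘inr = trans assoc (trans (cong (k ·_) inject₂) (trans []-·-exit ·-identityˡ))
      τ-route : k · (τ ∘ inl) ≡ N
      τ-route = begin
        k · (τ ∘ inl)                             ≡⟨ cong (k ·_) inject₁ ⟩
        k · ((η ∘ (id ⊕ inl)) · f′)               ≡⟨ ·-absorbs-η∘ ⟩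
        (k ∘ (id ⊕ inl)) · f′
          ≡⟨ cong (_· f′) (trans ∘-[] (cong₂ [_,_]
               (trans (sym assoc) (trans (cong (_∘ id) inject₁) identityʳ))
               (trans (sym assoc) (trans (cong (_∘ inl) inject₂) assoc)))) ⟩
        [ η , η ∘ (inr ∘ inl) ] · f′              ≡⟨ []-·-map₁-inr ⟩
        [ η ∘ inr , η ∘ (inr ∘ inl) ] · map₁-inr f ≡⟨ []-·-map₁-inr ⟩
        N                                         ∎
      τ′-route : k · (τ′ ∘ inl) ≡ N
      τ′-route = begin
        k · (τ′ ∘ inl)                            ≡⟨ cong (k ·_) inject₁ ⟩
        k · ([ (η ∘ inr) ∘ inr , η ∘ (inl ∘ (inr ∘ inl)) ] · f) ≡⟨ sym ·-assoc ⟩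
        (k · [ (η ∘ inr) ∘ inr , η ∘ (inl ∘ (inr ∘ inl)) ]) · f
          ≡⟨ cong (_· f) (trans ∘-[] (cong₂ [_,_]
               (trans (cong (k ·_) assoc) []-·-η∘inr) []-·-η∘inl)) ⟩
        N                                         ∎

    g·f†≡h† : g · f † ≡ h †
    g·f†≡h† = begin
      g · f †   ≡⟨ sym σ†∘inl ⟩
      σ † ∘ inl ≡⟨ cong (_∘ inl) (codiagonal-transfer codiagonal τ τ′ τ† τ′†
                                                         collapse) ⟩
      ρ † ∘ inl ≡⟨ ρ†∘inl ⟩
      h †       ∎

  naturality-from-inr : (_† : DaggerOp) → Fixpoint _† → Codiagonal _† →
    Uniformity _† → NaturalityInr _† → Naturality _†
  naturality-from-inr _† fixpoint codiagonal uniformity naturalityInr g f =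
    NaturalityFromInr.g·f†≡h† _† fixpoint codiagonal uniformity naturalityInr g f

proposition5 : ∀ {o ℓ} (C : Category o ℓ) (CP : BinaryCoproducts C)
    (M : KleisliTriple C) (dag : Iteration.DaggerOp CP M) →
    Iteration.Fixpoint CP M dag →
    Iteration.Codiagonal CP M dag →
    Iteration.Uniformity CP M dag →
    Iteration.NaturalityInr CP M dag →
    Iteration.IsElgot CP M dag
proposition5 C CP M dag fix cod uni nin = record
  { fixpoint   = fix
  ; naturality = IterationLemmas.naturality-from-inr CP M dag fix cod uni nin
  ; codiagonal = cod
  ; uniformity = uni
  }
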